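{- Let $G$ be an essentially $2$-edge-connected graph and let $xy\in E(G)$ be an edge with $d_G(x)\ge 2$ and $d_G(y)\ge 2$. If $|E(G-\{x,y\})|\le 2$, then $G$ has a dominating closed trail containing both $x$ and $y$.
   Context: A graph $G$ is essentially $2$-edge-connected if it is connected and for every edge cut $X$ with $|X|\le 1$, at most one component of $G-X$ contains an edge. A dominating closed trail (DCT) of $G$ is a closed trail $T$ in $G$ such that every edge of $G$ has at least one endvertex on $T$. $G-\{x,y\}$ denotes the graph obtained by deleting $x$ and $y$ and their incident edges. -}

module Defs where

open import Data.Nat using (ℕ)
open import Data.Fin using (Fin; _≟_)
open import Data.Fin.Properties using () renaming (_≟_ to _≟F_)
open import Data.Product using (Σ; _×_; _,_; proj₁; proj₂)
open import Data.Sum using (_⊎_)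
open import Data.Sum.Relation.Unary.All using ()
open import Data.List using (List; []; _∷_; filter; length)
open import Data.List.Base using (allFin)
open import Data.List.Membership.Propositional using (_∈_)
open import Data.List.Relation.Unary.All using (All)
open import Data.List.Relation.Unary.Unique.Propositional using (Unique)
open import Relation.Binary.PropositionalEquality using (_≡_; _≢_)
open import Relation.Nullary.Decidable using (_⊎-dec_; ¬?)
open import Relation.Nullary using (¬_)

record Graph : Set where
  field
    n     : ℕ
    m     : ℕ
    ends  : Fin m → Fin n × Fin n
    loopless : ∀ e → proj₁ (ends e) ≢ proj₂ (ends e)

module _ (G : Graph) where
  open Graph G

  Vertex : Set
  Vertex = Fin n

  Edge : Set
  Edge = Fin m

  Joins : Edge → Vertex → Vertex → Set
  Joins e u w = ends e ≡ (u , w) ⊎ ends e ≡ (w , u)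

  Incident : Vertex → Edge → Set
  Incident v e = proj₁ (ends e) ≡ v ⊎ proj₂ (ends e) ≡ v

  degree : Vertex → ℕ
  degree v = length (filter (λ e → (proj₁ (ends e) ≟ v) ⊎-dec (proj₂ (ends e) ≟ v)) (allFin m))

  data Walk : Vertex → Vertex → Set where
    []   : ∀ {v} → Walk v v
    step : ∀ {u w v} (e : Edge) → Joins e u w → Walk w v → Walk u v

  walkEdges : ∀ {u v} → Walk u v → List Edge
  walkEdges []             = []
  walkEdges (step e _ p)   = e ∷ walkEdges p

  walkVertices : ∀ {u v} → Walk u v → List Vertex
  walkVertices {u} []           = u ∷ []
  walkVertices {u} (step e _ p) = u ∷ walkVertices p

  Connected : Set
  Connected = ∀ (u v : Vertex) → Walk u v

  ConnectedAvoiding : Edge → Vertex → Vertex → Set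
  ConnectedAvoiding d u v = Σ (Walk u v) λ p → All (λ e → e ≢ d) (walkEdges p)

  -- G is essentially 2-edge-connected: connected, and for every edge cut X
  -- with |X| ≤ 1, at most one component of G - X contains an edge.
  -- X = ∅ is covered by connectivity; for X = {d}, any two edges e, f
  -- of G - d lie in the same component of G - d.
  Essentially2EdgeConnected : Set
  Essentially2EdgeConnected =
    Connected ×
    (∀ (d e f : Edge) → e ≢ d → f ≢ d →
       ConnectedAvoiding d (proj₁ (ends e)) (proj₁ (ends f)))

  edgesAvoiding2 : Vertex → Vertex → ℕ
  edgesAvoiding2 x y = length (filter
    (λ e → ¬? ((proj₁ (ends e) ≟ x) ⊎-dec (proj₂ (ends e) ≟ x) ⊎-dec
               (proj₁ (ends e) ≟ y) ⊎-dec (proj₂ (ends e) ≟ y)))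
    (allFin m))

  record ClosedTrail : Set where
    field
      base  : Vertex
      walk  : Walk base base
      trail : Unique (walkEdges walk)

  open ClosedTrail public

  onTrail : ClosedTrail → Vertex → Set
  onTrail T v = v ∈ walkVertices (walk T)

  Dominating : ClosedTrail → Set
  Dominating T = ∀ (e : Edge) → onTrail T (proj₁ (ends e)) ⊎ onTrail T (proj₂ (ends e))

-- Call the vertices other than x and y inner. The at most two inner edges form one or two
-- components K. Deleting an attachment edge of K (joining K to x or y) keeps K connected to xy,
-- so K has two distinct attachments, and together with the edges of K they give an ear: a trail
-- from {x, y} through K back to {x, y} passing a vertex that dominates every edge of K (for a
-- path a - b - c its middle vertex b, reached if necessary through a third attachment). An ear
-- from x to y closes up with xy; ears returning to their start are closed up by a second x-y path
-- avoiding xy, of length at most two, which exists since x and y have degree at least 2. Edges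
-- meeting x or y are dominated by x and y themselves.
module Submission where

open import Defs
open import Data.Nat using (_≤_; _≥_; s≤s)
open import Data.Product using (Σ; _×_; _,_; proj₁; proj₂)
open import Data.Sum using (_⊎_; inj₁; inj₂; [_,_]; swap)
open import Data.Fin using (_≟_)
open import Data.Fin.Properties using (any?)
open import Data.List using (List; []; _∷_; _++_; filter; length)
open import Data.List.Base using (allFin)
open import Data.List.Membership.Propositional using (_∈_)
open import Data.List.Membership.Propositional.Properties using (∈-filter⁺; ∈-filter⁻; ∈-allFin; ∈-++⁻)
open import Data.List.Relation.Unary.All as All using (All; []; _∷_)
import Data.List.Relation.Unary.All.Properties as All
open import Data.List.Relation.Unary.Any using (here; there)
import Data.List.Relation.Unary.Any.Properties as Any
open import Data.List.Relation.Unary.Any.Properties using (¬Any[])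
open import Data.List.Relation.Unary.Unique.Propositional using (Unique)
import Data.List.Relation.Unary.Unique.Propositional.Properties as Unique
open import Data.List.Relation.Unary.AllPairs using ([]; _∷_)
open import Data.List.Relation.Binary.Disjoint.Propositional using (Disjoint)
open import Relation.Binary.PropositionalEquality using (_≡_; _≢_; refl; sym; trans; cong; cong₂; subst)
open import Relation.Nullary using (¬_; Dec; yes; no)
open import Relation.Nullary.Decidable using (_⊎-dec_; _×-dec_; ¬?)
open import Relation.Unary using (Decidable)
open import Data.Empty using (⊥; ⊥-elim)

module _ {A : Set} where

  All⇒Disjoint : ∀ {P Q : A → Set} {xs ys : List A} → All P xs → All Q ys →
                 (∀ {a} → P a → Q a → ⊥) → Disjoint xs ys
  All⇒Disjoint ps qs P∩Q=∅ (i , j) = P∩Q=∅ (All.lookup ps i) (All.lookup qs j)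

  Disjoint-++ʳ : ∀ {xs ys zs : List A} → Disjoint xs ys → Disjoint xs zs → Disjoint xs (ys ++ zs)
  Disjoint-++ʳ {ys = ys} xs#ys xs#zs (i , j) with ∈-++⁻ ys j
  ... | inj₁ j′ = xs#ys (i , j′)
  ... | inj₂ j′ = xs#zs (i , j′)

  Disjoint-[]ˡ : ∀ {ys : List A} → Disjoint [] ys
  Disjoint-[]ˡ (() , _)

  Disjoint-[]ʳ : ∀ {xs : List A} → Disjoint xs []
  Disjoint-[]ʳ (_ , ())

  ∈-pair⁻ : ∀ {a b c : A} → a ∈ b ∷ c ∷ [] → a ≡ b ⊎ a ≡ c
  ∈-pair⁻ (here a≡b) = inj₁ a≡b
  ∈-pair⁻ (there (here a≡c)) = inj₂ a≡c

module GraphFacts (G : Graph) where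
  open Graph G

  V : Set
  V = Vertex G

  E : Set
  E = Edge G

  end₁ end₂ : E → V
  end₁ e = proj₁ (ends e)
  end₂ e = proj₂ (ends e)

  _++ʷ_ : ∀ {u v w} → Walk G u v → Walk G v w → Walk G u w
  [] ++ʷ q = q
  step e j p ++ʷ q = step e j (p ++ʷ q)

  walkEdges-++ʷ : ∀ {u v w} (p : Walk G u v) (q : Walk G v w) →
                  walkEdges G (p ++ʷ q) ≡ walkEdges G p ++ walkEdges G q
  walkEdges-++ʷ [] q = refl
  walkEdges-++ʷ (step e j p) q = cong (e ∷_) (walkEdges-++ʷ p q)

  start∈walkVertices : ∀ {u v} (p : Walk G u v) → u ∈ walkVertices G p
  start∈walkVertices [] = here refl
  start∈walkVertices (step e j p) = here refl

  walkVertices-++ʷˡ : ∀ {u v w a} (p : Walk G u v) (q : Walk G v w) →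
                      a ∈ walkVertices G p → a ∈ walkVertices G (p ++ʷ q)
  walkVertices-++ʷˡ [] q (here refl) = start∈walkVertices q
  walkVertices-++ʷˡ (step e j p) q (here refl) = here refl
  walkVertices-++ʷˡ (step e j p) q (there i) = there (walkVertices-++ʷˡ p q i)

  walkVertices-++ʷʳ : ∀ {u v w a} (p : Walk G u v) (q : Walk G v w) →
                      a ∈ walkVertices G q → a ∈ walkVertices G (p ++ʷ q)
  walkVertices-++ʷʳ [] q i = i
  walkVertices-++ʷʳ (step e j p) q i = there (walkVertices-++ʷʳ p q i)

  Joins-sym : ∀ {e u w} → Joins G e u w → Joins G e w u
  Joins-sym (inj₁ p) = inj₂ p
  Joins-sym (inj₂ p) = inj₁ p

  joins-ends : (e : E) → Joins G e (end₁ e) (end₂ e)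
  joins-ends e = inj₁ refl

  Joins-ends : ∀ {e u w} → Joins G e u w →
               (end₁ e ≡ u × end₂ e ≡ w) ⊎ (end₁ e ≡ w × end₂ e ≡ u)
  Joins-ends (inj₁ p) = inj₁ (cong proj₁ p , cong proj₂ p)
  Joins-ends (inj₂ p) = inj₂ (cong proj₁ p , cong proj₂ p)

  Joins-unique : ∀ {e a b c d} → Joins G e a b → Joins G e c d →
                 (a ≡ c × b ≡ d) ⊎ (a ≡ d × b ≡ c)
  Joins-unique j k with Joins-ends j | Joins-ends k
  ... | inj₁ (p₁ , p₂) | inj₁ (q₁ , q₂) = inj₁ (trans (sym p₁) q₁ , trans (sym p₂) q₂)
  ... | inj₁ (p₁ , p₂) | inj₂ (q₁ , q₂) = inj₂ (trans (sym p₁) q₁ , trans (sym p₂) q₂)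
  ... | inj₂ (p₁ , p₂) | inj₁ (q₁ , q₂) = inj₂ (trans (sym p₂) q₂ , trans (sym p₁) q₁)
  ... | inj₂ (p₁ , p₂) | inj₂ (q₁ , q₂) = inj₁ (trans (sym p₂) q₂ , trans (sym p₁) q₁)

  Joins⇒≢ : ∀ {e a b} → Joins G e a b → a ≢ b
  Joins⇒≢ {e} j a≡b with Joins-ends j
  ... | inj₁ (p₁ , p₂) = loopless e (trans p₁ (trans a≡b (sym p₂)))
  ... | inj₂ (p₁ , p₂) = loopless e (trans p₁ (trans (sym a≡b) (sym p₂)))

  Joins⇒Incident : ∀ {e a b} → Joins G e a b → Incident G a e
  Joins⇒Incident j with Joins-ends j
  ... | inj₁ (p₁ , _) = inj₁ p₁
  ... | inj₂ (_ , p₂) = inj₂ p₂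

  Incident⇒Joins : ∀ {e v} → Incident G v e → Σ V λ t → Joins G e v t
  Incident⇒Joins {e} (inj₁ p) = end₂ e , inj₁ (cong₂ _,_ p refl)
  Incident⇒Joins {e} (inj₂ p) = end₁ e , inj₂ (cong₂ _,_ refl p)

  Joins? : ∀ e a b → Dec (Joins G e a b)
  Joins? e a b with (end₁ e ≟ a) ×-dec (end₂ e ≟ b) | (end₁ e ≟ b) ×-dec (end₂ e ≟ a)
  ... | yes (p , q) | _ = yes (inj₁ (cong₂ _,_ p q))
  ... | no _ | yes (p , q) = yes (inj₂ (cong₂ _,_ p q))
  ... | no ¬ab | no ¬ba = no λ j → [ ¬ab , ¬ba ] (Joins-ends j)

  walkToEnd₁ : ∀ {e u w} → Joins G e u w → Σ (Walk G u (end₁ e)) λ p → All (_≡ e) (walkEdges G p)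
  walkToEnd₁ {e} j with Joins-ends j
  ... | inj₁ (refl , _) = [] , []
  ... | inj₂ (refl , _) = step e j [] , refl ∷ []

  walkFromEnd₁ : ∀ {e u w} → Joins G e u w → Σ (Walk G (end₁ e) u) λ p → All (_≡ e) (walkEdges G p)
  walkFromEnd₁ {e} j with Joins-ends j
  ... | inj₁ (refl , _) = [] , []
  ... | inj₂ (refl , _) = step e (Joins-sym j) [] , refl ∷ []

  EndOf : E → V → Set
  EndOf f w = w ≡ end₁ f ⊎ w ≡ end₂ f

  endOf? : (f : E) → Decidable (EndOf f)
  endOf? f w = (w ≟ end₁ f) ⊎-dec (w ≟ end₂ f)

  Joins⇒EndOf : ∀ {e k t} → Joins G e k t → EndOf e k × EndOf e t
  Joins⇒EndOf j with Joins-ends j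
  ... | inj₁ (p₁ , p₂) = inj₁ (sym p₁) , inj₂ (sym p₂)
  ... | inj₂ (p₁ , p₂) = inj₂ (sym p₂) , inj₁ (sym p₁)

  EndOf⇒Incident : ∀ {e w} → EndOf e w → Incident G w e
  EndOf⇒Incident (inj₁ refl) = inj₁ refl
  EndOf⇒Incident (inj₂ refl) = inj₂ refl

  EndOf-⊆ : ∀ {f g w} → EndOf f (end₁ g) → EndOf f (end₂ g) → EndOf g w → EndOf f w
  EndOf-⊆ p q (inj₁ refl) = p
  EndOf-⊆ p q (inj₂ refl) = q

  parallel-incident : ∀ {f g w} → EndOf f (end₁ g) → EndOf f (end₂ g) → EndOf f w → Incident G w g
  parallel-incident (inj₁ p) _ (inj₁ refl) = inj₁ p
  parallel-incident (inj₂ p) _ (inj₂ refl) = inj₁ p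
  parallel-incident {g = g} (inj₁ p) (inj₁ q) (inj₂ refl) = ⊥-elim (loopless g (trans p (sym q)))
  parallel-incident (inj₁ p) (inj₂ q) (inj₂ refl) = inj₂ q
  parallel-incident (inj₂ p) (inj₁ q) (inj₁ refl) = inj₂ q
  parallel-incident {g = g} (inj₂ p) (inj₂ q) (inj₁ refl) = ⊥-elim (loopless g (trans p (sym q)))

  leavingEdge : (S : V → Set) → Decidable S → ∀ {u v} (p : Walk G u v) → S u → ¬ S v →
                Σ E λ g → g ∈ walkEdges G p × Σ V λ s → Σ V λ t → Joins G g s t × S s × ¬ S t
  leavingEdge S S? [] Su ¬Sv = ⊥-elim (¬Sv Su)
  leavingEdge S S? (step {u} {w} e j p) Su ¬Sv with S? w
  ... | yes Sw = let (g , g∈p , rest) = leavingEdge S S? p Sw ¬Sv in g , there g∈p , rest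
  ... | no ¬Sw = e , here refl , u , w , j , Su , ¬Sw

  anotherIncidentEdge : ∀ (v : V) (e₀ : E) → degree G v ≥ 2 →
                        Σ E λ a → (Σ V λ t → Joins G a v t) × a ≢ e₀
  anotherIncidentEdge v e₀ deg≥2 with second (filter incident? (allFin m)) deg≥2
                                            (Unique.filter⁺ incident? (Unique.allFin⁺ m))
                                            (All.all-filter incident? (allFin m))
    where
    incident? : Decidable (Incident G v)
    incident? e = (proj₁ (ends e) ≟ v) ⊎-dec (proj₂ (ends e) ≟ v)
    second : ∀ (l : List E) → 2 ≤ length l → Unique l → All (Incident G v) l →
             Σ E λ a → Incident G v a × a ≢ e₀
    second [] () _ _
    second (_ ∷ []) (s≤s ()) _ _
    second (a₁ ∷ a₂ ∷ l) _ ((a₁≢a₂ ∷ _) ∷ _) (i₁ ∷ i₂ ∷ _) with a₁ ≟ e₀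
    ... | yes refl = a₂ , i₂ , λ eq → a₁≢a₂ (sym eq)
    ... | no a₁≢e₀ = a₁ , i₁ , a₁≢e₀
  ... | a , inc , a≢e₀ = a , Incident⇒Joins inc , a≢e₀

module _ (G : Graph) (ec : Essentially2EdgeConnected G) where
  open GraphFacts G

  walkAvoiding : ∀ (d e f : E) {u u′ v v′} → e ≢ d → f ≢ d → Joins G e u u′ → Joins G f v v′ →
                 Σ (Walk G u v) λ p → All (_≢ d) (walkEdges G p)
  walkAvoiding d e f e≢d f≢d je jf =
    p₁ ++ʷ (p₂ ++ʷ p₃) ,
    subst (All (_≢ d)) (sym edges-eq)
      (All.++⁺ (All.map (λ { refl → e≢d }) a₁) (All.++⁺ a₂ (All.map (λ { refl → f≢d }) a₃)))
    where
    p₁ = proj₁ (walkToEnd₁ je)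
    a₁ = proj₂ (walkToEnd₁ je)
    p₂ = proj₁ (proj₂ ec d e f e≢d f≢d)
    a₂ = proj₂ (proj₂ ec d e f e≢d f≢d)
    p₃ = proj₁ (walkFromEnd₁ jf)
    a₃ = proj₂ (walkFromEnd₁ jf)
    edges-eq : walkEdges G (p₁ ++ʷ (p₂ ++ʷ p₃)) ≡ walkEdges G p₁ ++ (walkEdges G p₂ ++ walkEdges G p₃)
    edges-eq = trans (walkEdges-++ʷ p₁ (p₂ ++ʷ p₃)) (cong (walkEdges G p₁ ++_) (walkEdges-++ʷ p₂ p₃))

module TrailThroughEdge (G : Graph) (ec : Essentially2EdgeConnected G)
                        (x y : Vertex G) (e₀ : Edge G) (xy : Joins G e₀ x y) where
  open Graph G
  open GraphFacts G

  x≢y : x ≢ y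
  x≢y = Joins⇒≢ xy

  Terminal : V → Set
  Terminal v = v ≡ x ⊎ v ≡ y

  terminal? : Decidable Terminal
  terminal? v = (v ≟ x) ⊎-dec (v ≟ y)

  x-terminal : Terminal x
  x-terminal = inj₁ refl

  y-terminal : Terminal y
  y-terminal = inj₂ refl

  Inner : V → Set
  Inner v = ¬ Terminal v

  InnerEdge : E → Set
  InnerEdge e = Inner (end₁ e) × Inner (end₂ e)

  Joins⇒InnerEdge : ∀ {e a b} → Joins G e a b → Inner a → Inner b → InnerEdge e
  Joins⇒InnerEdge j ia ib with Joins-ends j
  ... | inj₁ (refl , refl) = ia , ib
  ... | inj₂ (refl , refl) = ib , ia

  InnerEdge⇒Inner : ∀ {e a b} → Joins G e a b → InnerEdge e → Inner a × Inner b
  InnerEdge⇒Inner j (i₁ , i₂) with Joins-ends j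
  ... | inj₁ (refl , refl) = i₁ , i₂
  ... | inj₂ (refl , refl) = i₂ , i₁

  attachment-not-inner : ∀ {e a s} → Joins G e a s → Terminal s → ¬ InnerEdge e
  attachment-not-inner j ts ie = proj₂ (InnerEdge⇒Inner j ie) ts

  -- The same decision procedure as in edgesAvoiding2, so that the length of innerEdges is that number.
  AvoidsXY : E → Set
  AvoidsXY e = ¬ (end₁ e ≡ x ⊎ end₂ e ≡ x ⊎ end₁ e ≡ y ⊎ end₂ e ≡ y)

  avoidsXY? : Decidable AvoidsXY
  avoidsXY? e = ¬? ((proj₁ (ends e) ≟ x) ⊎-dec (proj₂ (ends e) ≟ x) ⊎-dec
                    (proj₁ (ends e) ≟ y) ⊎-dec (proj₂ (ends e) ≟ y))

  innerEdges : List E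
  innerEdges = filter avoidsXY? (allFin m)

  InnerEdge⇒∈innerEdges : ∀ {e} → InnerEdge e → e ∈ innerEdges
  InnerEdge⇒∈innerEdges {e} (i₁ , i₂) = ∈-filter⁺ avoidsXY? (∈-allFin e) avoids
    where
    avoids : AvoidsXY e
    avoids (inj₁ p) = i₁ (inj₁ p)
    avoids (inj₂ (inj₁ p)) = i₂ (inj₁ p)
    avoids (inj₂ (inj₂ (inj₁ p))) = i₁ (inj₂ p)
    avoids (inj₂ (inj₂ (inj₂ p))) = i₂ (inj₂ p)

  ∈innerEdges⇒InnerEdge : ∀ {e} → e ∈ innerEdges → InnerEdge e
  ∈innerEdges⇒InnerEdge {e} i =
    (λ { (inj₁ p) → avoids (inj₁ p) ; (inj₂ p) → avoids (inj₂ (inj₂ (inj₁ p))) }) ,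
    (λ { (inj₁ p) → avoids (inj₂ (inj₁ p)) ; (inj₂ p) → avoids (inj₂ (inj₂ (inj₂ p))) })
    where
    avoids : AvoidsXY e
    avoids = proj₂ (∈-filter⁻ avoidsXY? {xs = allFin m} i)

  InnerSet : (V → Set) → Set
  InnerSet K = ∀ {v} → K v → Inner v

  EndOf-inner : ∀ {f w} → InnerEdge f → EndOf f w → Inner w
  EndOf-inner (i₁ , _) (inj₁ refl) = i₁
  EndOf-inner (_ , i₂) (inj₂ refl) = i₂

  -- The edges of the subgraph induced by K ∪ {x, y}, except those between x and y.
  EdgeOf : (V → Set) → E → Set
  EdgeOf K e = Σ V λ k → Σ V λ t → Joins G e k t × K k × (K t ⊎ Terminal t)

  EdgeOf-⊎ˡ : ∀ {K₁ K₂ : V → Set} {e} → EdgeOf K₁ e → EdgeOf (λ v → K₁ v ⊎ K₂ v) e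
  EdgeOf-⊎ˡ (k , t , j , Kk , inj₁ Kt) = k , t , j , inj₁ Kk , inj₁ (inj₁ Kt)
  EdgeOf-⊎ˡ (k , t , j , Kk , inj₂ Tt) = k , t , j , inj₁ Kk , inj₂ Tt

  EdgeOf-⊎ʳ : ∀ {K₁ K₂ : V → Set} {e} → EdgeOf K₂ e → EdgeOf (λ v → K₁ v ⊎ K₂ v) e
  EdgeOf-⊎ʳ (k , t , j , Kk , inj₁ Kt) = k , t , j , inj₂ Kk , inj₁ (inj₂ Kt)
  EdgeOf-⊎ʳ (k , t , j , Kk , inj₂ Tt) = k , t , j , inj₂ Kk , inj₂ Tt

  EdgeOf-disjoint : ∀ {K₁ K₂ e} → InnerSet K₁ → InnerSet K₂ → (∀ {v} → K₁ v → K₂ v → ⊥) →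
                    EdgeOf K₁ e → EdgeOf K₂ e → ⊥
  EdgeOf-disjoint inner₁ inner₂ K₁∩K₂=∅ (k₁ , t₁ , j₁ , Kk₁ , Kt₁) (k₂ , t₂ , j₂ , Kk₂ , Kt₂)
    with Joins-unique j₁ j₂
  ... | inj₁ (refl , _) = K₁∩K₂=∅ Kk₁ Kk₂
  ... | inj₂ (refl , refl) with Kt₂
  ...   | inj₁ Kt = K₁∩K₂=∅ Kk₁ Kt
  ...   | inj₂ Tt = inner₁ Kk₁ Tt

  EdgeOf⇒¬Joins-xy : ∀ {K e} → InnerSet K → EdgeOf K e → ¬ Joins G e x y
  EdgeOf⇒¬Joins-xy inner (k , t , j , Kk , _) jxy with Joins-unique j jxy
  ... | inj₁ (refl , _) = inner Kk x-terminal
  ... | inj₂ (refl , _) = inner Kk y-terminal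

  EdgeOf⇒≢e₀ : ∀ {K e} → InnerSet K → EdgeOf K e → e ≢ e₀
  EdgeOf⇒≢e₀ inner eK refl = EdgeOf⇒¬Joins-xy inner eK xy

  Attaches : (V → Set) → E → V → Set
  Attaches K h s = Σ V λ k → Joins G h k s × K k

  Attached : (V → Set) → V → Set
  Attached K s = Σ E λ h → Attaches K h s

  Attachment : (V → Set) → Set
  Attachment K = Σ E λ h → Σ V λ s → Attaches K h s × Terminal s

  Attaches⇒EdgeOf : ∀ {K h s} → Attaches K h s → Terminal s → EdgeOf K h
  Attaches⇒EdgeOf {s = s} (k , j , Kk) Ts = k , s , j , Kk , inj₂ Ts

  x-attachment≢y-attachment : ∀ {K hx hy} → InnerSet K → Attaches K hx x → Attaches K hy y → hx ≢ hy
  x-attachment≢y-attachment inner (kx , jx , Kkx) (ky , jy , Kky) refl with Joins-unique jx jy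
  ... | inj₁ (_ , x≡y) = x≢y x≡y
  ... | inj₂ (kx≡y , _) = inner Kkx (inj₂ kx≡y)

  attachments-from-distinct-ends : ∀ {h h′ k k′ s} → Joins G h k s → Joins G h′ k′ s → k ≢ k′ → h ≢ h′
  attachments-from-distinct-ends j j′ k≢k′ refl with Joins-unique j j′
  ... | inj₁ (k≡k′ , _) = k≢k′ k≡k′
  ... | inj₂ (refl , refl) = Joins⇒≢ j refl

  attachment-at-x : ∀ {K h s} → ¬ Attached K y → Attaches K h s → Terminal s → s ≡ x
  attachment-at-x ¬y _ (inj₁ s≡x) = s≡x
  attachment-at-x ¬y a (inj₂ refl) = ⊥-elim (¬y (_ , a))

  attachment-at-y : ∀ {K h s} → ¬ Attached K x → Attaches K h s → Terminal s → s ≡ y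
  attachment-at-y ¬x _ (inj₂ s≡y) = s≡y
  attachment-at-y ¬x a (inj₁ refl) = ⊥-elim (¬x (_ , a))

  -- C is chosen so that visiting one of its vertices dominates every inner edge of K.
  Ear : ∀ {a b} → (K C : V → Set) → Walk G a b → Set
  Ear K C p = Unique (walkEdges G p) × All (EdgeOf K) (walkEdges G p) × Σ V (λ w → C w × w ∈ walkVertices G p)

  data Ears (K C : V → Set) : Set where
    crossing : (p : Walk G x y) (q : Walk G y x) → Ear K C p → Ear K C q → Ears K C
    loopAtX  : (p : Walk G x x) → Ear K C p → ¬ Attached K y → Ears K C
    loopAtY  : (p : Walk G y y) → Ear K C p → ¬ Attached K x → Ears K C

  earThrough : ∀ {K C : V → Set} {I : E → Set} → (∀ {e} → I e → InnerEdge e) → (∀ {e} → I e → EdgeOf K e) →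
               ∀ {s₁ k₁ k₂ s₂} (h₁ : E) → Joins G h₁ k₁ s₁ → K k₁ → Terminal s₁ →
               (h₂ : E) → Joins G h₂ k₂ s₂ → K k₂ → Terminal s₂ → h₁ ≢ h₂ →
               (core : Walk G k₁ k₂) → Unique (walkEdges G core) → All I (walkEdges G core) →
               ∀ {w} → C w → w ∈ walkVertices G core → Σ (Walk G s₁ s₂) (Ear K C)
  earThrough {K} {I = I} I-inner I-edgeOf {s₁} {k₁} {k₂} {s₂} h₁ j₁ Kk₁ Ts₁ h₂ j₂ Kk₂ Ts₂ h₁≢h₂
             core unique coreI {w} Cw w∈core =
    p , subst Unique (sym edges-eq) isTrail , subst (All (EdgeOf K)) (sym edges-eq) edgesOf ,
    w , Cw , there (walkVertices-++ʷˡ core _ w∈core)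
    where
    p : Walk G s₁ s₂
    p = step h₁ (Joins-sym j₁) (core ++ʷ step h₂ j₂ [])
    edges-eq : walkEdges G p ≡ h₁ ∷ (walkEdges G core ++ h₂ ∷ [])
    edges-eq = cong (h₁ ∷_) (walkEdges-++ʷ core (step h₂ j₂ []))
    h₁∉core : ∀ {e} → I e → h₁ ≢ e
    h₁∉core Ie refl = attachment-not-inner j₁ Ts₁ (I-inner Ie)
    h₂∉core : ∀ {e} → I e → e ≢ h₂
    h₂∉core Ie refl = attachment-not-inner j₂ Ts₂ (I-inner Ie)
    isTrail : Unique (h₁ ∷ (walkEdges G core ++ h₂ ∷ []))
    isTrail = All.++⁺ (All.map h₁∉core coreI) (h₁≢h₂ ∷ []) ∷
              Unique.++⁺ unique ([] ∷ []) (All⇒Disjoint {Q = _≡ h₂} coreI (refl ∷ []) h₂∉core)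
    edgesOf : All (EdgeOf K) (h₁ ∷ (walkEdges G core ++ h₂ ∷ []))
    edgesOf = (k₁ , s₁ , j₁ , Kk₁ , inj₂ Ts₁) ∷
              All.++⁺ (All.map I-edgeOf coreI) ((k₂ , s₂ , j₂ , Kk₂ , inj₂ Ts₂) ∷ [])

  -- K is the vertex set of a component of G - {x, y} containing the edge f.
  module Attachments (K : V → Set) (K? : Decidable K) (K-inner : InnerSet K)
                     (K-closed : ∀ {e k t} → K k → Joins G e k t → K t ⊎ Terminal t)
                     {f : E} {a b : V} (jf : Joins G f a b) (Ka : K a) (Kb : K b) where

    attached? : (s : V) → Dec (Attached K s)
    attached? s with any? (λ h → (K? (end₁ h) ×-dec (end₂ h ≟ s)) ⊎-dec (K? (end₂ h) ×-dec (end₁ h ≟ s)))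
    ... | yes (h , inj₁ (K₁ , p)) = yes (h , end₁ h , inj₁ (cong₂ _,_ refl p) , K₁)
    ... | yes (h , inj₂ (K₂ , p)) = yes (h , end₂ h , inj₂ (cong₂ _,_ p refl) , K₂)
    ... | no ¬any = no λ { (h , k , j , Kk) → ¬any (h , oriented j Kk) }
      where
      oriented : ∀ {h k} → Joins G h k s → K k → (K (end₁ h) × end₂ h ≡ s) ⊎ (K (end₂ h) × end₁ h ≡ s)
      oriented j Kk with Joins-ends j
      ... | inj₁ (refl , p₂) = inj₁ (Kk , p₂)
      ... | inj₂ (p₁ , refl) = inj₂ (Kk , p₁)

    attachmentOn : ∀ {u} (p : Walk G u x) → K u →
                   Σ E λ h → h ∈ walkEdges G p × Σ V λ s → Attaches K h s × Terminal s
    attachmentOn p Ku with leavingEdge K K? p Ku (λ Kx → K-inner Kx x-terminal)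
    ... | h , h∈p , k , s , j , Kk , ¬Ks with K-closed Kk j
    ...   | inj₁ Ks = ⊥-elim (¬Ks Ks)
    ...   | inj₂ Ts = h , h∈p , s , (k , j , Kk) , Ts

    attachment : Attachment K
    attachment = let (h , _ , rest) = attachmentOn (proj₁ ec a x) Ka in h , rest

    -- Essential 2-edge-connectivity: deleting the attachment h leaves f and e₀ connected.
    anotherAttachment : ∀ {h s} → Attaches K h s → Terminal s →
                        Σ E λ h′ → h′ ≢ h × Σ V λ s′ → Attaches K h′ s′ × Terminal s′
    anotherAttachment {h} ah Ts with walkAvoiding G ec h f e₀ f≢h e₀≢h jf xy
      where
      f≢h : f ≢ h
      f≢h refl = attachment-not-inner (proj₁ (proj₂ ah)) Ts (Joins⇒InnerEdge jf (K-inner Ka) (K-inner Kb))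
      e₀≢h : e₀ ≢ h
      e₀≢h refl = EdgeOf⇒≢e₀ K-inner (Attaches⇒EdgeOf ah Ts) refl
    ... | p , avoids-h with attachmentOn p Ka
    ...   | h′ , h′∈p , rest = h′ , All.lookup avoids-h h′∈p , rest

  module EdgeComponent {f : E} {u v : V} (jf : Joins G f u v) (f-inner : InnerEdge f)
                       (closed : ∀ {e k t} → (k ≡ u ⊎ k ≡ v) → Joins G e k t → Inner t → t ≡ u ⊎ t ≡ v) where

    K : V → Set
    K w = w ≡ u ⊎ w ≡ v

    K? : Decidable K
    K? w = (w ≟ u) ⊎-dec (w ≟ v)

    K-inner : InnerSet K
    K-inner (inj₁ refl) = proj₁ (InnerEdge⇒Inner jf f-inner)
    K-inner (inj₂ refl) = proj₂ (InnerEdge⇒Inner jf f-inner)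

    K-closed : ∀ {e k t} → K k → Joins G e k t → K t ⊎ Terminal t
    K-closed {t = t} Kk j with terminal? t
    ... | yes Tt = inj₂ Tt
    ... | no it = inj₁ (closed Kk j it)

    open Attachments K K? K-inner K-closed jf (inj₁ refl) (inj₂ refl)

    core : ∀ {k₁ k₂} → K k₁ → K k₂ →
           Σ (Walk G k₁ k₂) λ p → Unique (walkEdges G p) × All (_≡ f) (walkEdges G p)
    core (inj₁ refl) (inj₁ refl) = [] , [] , []
    core (inj₁ refl) (inj₂ refl) = step f jf [] , [] ∷ [] , refl ∷ []
    core (inj₂ refl) (inj₁ refl) = step f (Joins-sym jf) [] , [] ∷ [] , refl ∷ []
    core (inj₂ refl) (inj₂ refl) = [] , [] , []

    ear : ∀ {s₁ s₂} (h₁ : E) → Attaches K h₁ s₁ → Terminal s₁ →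
          (h₂ : E) → Attaches K h₂ s₂ → Terminal s₂ → h₁ ≢ h₂ → Σ (Walk G s₁ s₂) (Ear K K)
    ear h₁ (k₁ , j₁ , Kk₁) Ts₁ h₂ (k₂ , j₂ , Kk₂) Ts₂ h₁≢h₂ =
      let (c , unique , c-f) = core Kk₁ Kk₂
      in earThrough (λ { refl → f-inner }) (λ { refl → u , v , jf , inj₁ refl , inj₁ (inj₂ refl) })
                    h₁ j₁ Kk₁ Ts₁ h₂ j₂ Kk₂ Ts₂ h₁≢h₂ c unique c-f Kk₁ (start∈walkVertices c)

    loopAt : ∀ {s} → (∀ {h s′} → Attaches K h s′ → Terminal s′ → s′ ≡ s) → Σ (Walk G s s) (Ear K K)
    loopAt only-s with attachment
    ... | h₁ , s₁ , a₁ , T₁ with anotherAttachment a₁ T₁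
    ...   | h₂ , h₂≢h₁ , s₂ , a₂ , T₂ with only-s a₁ T₁ | only-s a₂ T₂
    ...     | refl | refl = ear h₁ a₁ T₁ h₂ a₂ T₂ (λ e → h₂≢h₁ (sym e))

    ears : Ears K K
    ears with attached? x | attached? y
    ... | yes (hx , ax) | yes (hy , ay) =
          crossing (proj₁ P) (proj₁ Q) (proj₂ P) (proj₂ Q)
      where
      hx≢hy = x-attachment≢y-attachment K-inner ax ay
      P = ear hx ax x-terminal hy ay y-terminal hx≢hy
      Q = ear hy ay y-terminal hx ax x-terminal (λ e → hx≢hy (sym e))
    ... | yes _ | no ¬y = let (p , ep) = loopAt (attachment-at-x ¬y) in loopAtX p ep ¬y
    ... | no ¬x | yes _ = let (p , ep) = loopAt (attachment-at-y ¬x) in loopAtY p ep ¬x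
    ... | no ¬x | no ¬y with attachment
    ...   | h , _ , a , inj₁ refl = ⊥-elim (¬x (h , a))
    ...   | h , _ , a , inj₂ refl = ⊥-elim (¬y (h , a))

  -- In a two-edge path a -f- b -g- c that contains all inner edges, deleting f keeps g connected to e₀,
  -- and the connecting walk leaves {b, c} along an attachment.
  module BeyondFirstEdge {f g : E} {a b c : V} (jf : Joins G f a b) (jg : Joins G g b c)
                         (ib : Inner b) (ic : Inner c) (g≢f : g ≢ f)
                         (only-fg : ∀ {e} → InnerEdge e → e ≡ f ⊎ e ≡ g) where

    BC : V → Set
    BC w = w ≡ b ⊎ w ≡ c

    BC-inner : InnerSet BC
    BC-inner (inj₁ refl) = ib
    BC-inner (inj₂ refl) = ic

    ¬BC-x : ¬ BC x
    ¬BC-x (inj₁ x≡b) = ib (inj₁ (sym x≡b))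
    ¬BC-x (inj₂ x≡c) = ic (inj₁ (sym x≡c))

    e₀≢f : e₀ ≢ f
    e₀≢f refl with Joins-unique jf xy
    ... | inj₁ (_ , b≡y) = ib (inj₂ b≡y)
    ... | inj₂ (_ , b≡x) = ib (inj₁ b≡x)

    attachment : Σ E λ h → Σ V λ s → Attaches BC h s × Terminal s
    attachment with walkAvoiding G ec f g e₀ g≢f e₀≢f jg xy
    ... | p , avoids-f with leavingEdge BC (λ w → (w ≟ b) ⊎-dec (w ≟ c)) p (inj₁ refl) ¬BC-x
    ...   | h , h∈p , s , t , j , BCs , ¬BCt with terminal? t
    ...     | yes Tt = h , t , (s , j , BCs) , Tt
    ...     | no it with only-fg (Joins⇒InnerEdge j (BC-inner BCs) it)
    ...       | inj₁ refl = ⊥-elim (All.lookup avoids-f h∈p refl)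
    ...       | inj₂ refl with Joins-unique j jg
    ...         | inj₁ (_ , t≡c) = ⊥-elim (¬BCt (inj₂ t≡c))
    ...         | inj₂ (_ , t≡b) = ⊥-elim (¬BCt (inj₁ t≡b))

  module PathComponent {f₁ f₂ : E} {a b c : V} (j₁ : Joins G f₁ a b) (j₂ : Joins G f₂ b c) (a≢c : a ≢ c)
                       (ia : Inner a) (ib : Inner b) (ic : Inner c)
                       (only-f₁f₂ : ∀ {e} → InnerEdge e → e ≡ f₁ ⊎ e ≡ f₂) where

    a≢b : a ≢ b
    a≢b = Joins⇒≢ j₁

    b≢c : b ≢ c
    b≢c = Joins⇒≢ j₂

    K : V → Set
    K w = w ≡ a ⊎ w ≡ b ⊎ w ≡ c

    K? : Decidable K
    K? w = (w ≟ a) ⊎-dec (w ≟ b) ⊎-dec (w ≟ c)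

    K-inner : InnerSet K
    K-inner (inj₁ refl) = ia
    K-inner (inj₂ (inj₁ refl)) = ib
    K-inner (inj₂ (inj₂ refl)) = ic

    f₁≢f₂ : f₁ ≢ f₂
    f₁≢f₂ refl with Joins-unique j₁ j₂
    ... | inj₁ (a≡b , _) = a≢b a≡b
    ... | inj₂ (a≡c , _) = a≢c a≡c

    K-closed : ∀ {e k t} → K k → Joins G e k t → K t ⊎ Terminal t
    K-closed {t = t} Kk j with terminal? t
    ... | yes Tt = inj₂ Tt
    ... | no it with only-f₁f₂ (Joins⇒InnerEdge j (K-inner Kk) it)
    ...   | inj₁ refl with Joins-unique j j₁
    ...     | inj₁ (_ , refl) = inj₁ (inj₂ (inj₁ refl))
    ...     | inj₂ (_ , refl) = inj₁ (inj₁ refl)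
    K-closed Kk j | no it | inj₂ refl with Joins-unique j j₂
    ...     | inj₁ (_ , refl) = inj₁ (inj₂ (inj₂ refl))
    ...     | inj₂ (_ , refl) = inj₁ (inj₂ (inj₁ refl))

    open Attachments K K? K-inner K-closed j₁ (inj₁ refl) (inj₂ (inj₁ refl))

    I : E → Set
    I e = e ≡ f₁ ⊎ e ≡ f₂

    I-inner : ∀ {e} → I e → InnerEdge e
    I-inner (inj₁ refl) = Joins⇒InnerEdge j₁ ia ib
    I-inner (inj₂ refl) = Joins⇒InnerEdge j₂ ib ic

    I-edgeOf : ∀ {e} → I e → EdgeOf K e
    I-edgeOf (inj₁ refl) = a , b , j₁ , inj₁ refl , inj₁ (inj₂ (inj₁ refl))
    I-edgeOf (inj₂ refl) = b , c , j₂ , inj₂ (inj₁ refl) , inj₁ (inj₂ (inj₂ refl))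

    -- A subpath of a - b - c from k₁ to k₂ passes through b exactly in these cases.
    Spread : V → V → Set
    Spread k₁ k₂ = k₁ ≢ k₂ ⊎ k₁ ≡ b

    Spread-sym : ∀ {k₁ k₂} → Spread k₁ k₂ → Spread k₂ k₁
    Spread-sym (inj₁ k₁≢k₂) = inj₁ (λ e → k₁≢k₂ (sym e))
    Spread-sym {k₂ = k₂} (inj₂ refl) with k₂ ≟ b
    ... | yes k₂≡b = inj₂ k₂≡b
    ... | no k₂≢b = inj₁ k₂≢b

    core : ∀ {k₁ k₂} → K k₁ → K k₂ → Spread k₁ k₂ →
           Σ (Walk G k₁ k₂) λ p → Unique (walkEdges G p) × All I (walkEdges G p) × b ∈ walkVertices G p
    core (inj₁ refl) (inj₁ refl) (inj₁ n) = ⊥-elim (n refl)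
    core (inj₁ refl) (inj₁ refl) (inj₂ a≡b) = ⊥-elim (a≢b a≡b)
    core (inj₁ refl) (inj₂ (inj₁ refl)) _ =
      step f₁ j₁ [] , [] ∷ [] , inj₁ refl ∷ [] , there (here refl)
    core (inj₁ refl) (inj₂ (inj₂ refl)) _ =
      step f₁ j₁ (step f₂ j₂ []) , (f₁≢f₂ ∷ []) ∷ [] ∷ [] , inj₁ refl ∷ inj₂ refl ∷ [] , there (here refl)
    core (inj₂ (inj₁ refl)) (inj₁ refl) _ =
      step f₁ (Joins-sym j₁) [] , [] ∷ [] , inj₁ refl ∷ [] , here refl
    core (inj₂ (inj₁ refl)) (inj₂ (inj₁ refl)) _ = [] , [] , [] , here refl
    core (inj₂ (inj₁ refl)) (inj₂ (inj₂ refl)) _ =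
      step f₂ j₂ [] , [] ∷ [] , inj₂ refl ∷ [] , here refl
    core (inj₂ (inj₂ refl)) (inj₁ refl) _ =
      step f₂ (Joins-sym j₂) (step f₁ (Joins-sym j₁) []) , ((λ e → f₁≢f₂ (sym e)) ∷ []) ∷ [] ∷ [] ,
      inj₂ refl ∷ inj₁ refl ∷ [] , there (here refl)
    core (inj₂ (inj₂ refl)) (inj₂ (inj₁ refl)) _ =
      step f₂ (Joins-sym j₂) [] , [] ∷ [] , inj₂ refl ∷ [] , there (here refl)
    core (inj₂ (inj₂ refl)) (inj₂ (inj₂ refl)) (inj₁ n) = ⊥-elim (n refl)
    core (inj₂ (inj₂ refl)) (inj₂ (inj₂ refl)) (inj₂ c≡b) = ⊥-elim (b≢c (sym c≡b))

    ear : ∀ {s₁ s₂} (h₁ : E) (a₁ : Attaches K h₁ s₁) → Terminal s₁ →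
          (h₂ : E) (a₂ : Attaches K h₂ s₂) → Terminal s₂ → h₁ ≢ h₂ →
          Spread (proj₁ a₁) (proj₁ a₂) → Σ (Walk G s₁ s₂) (Ear K (_≡ b))
    ear h₁ (k₁ , jh₁ , Kk₁) T₁ h₂ (k₂ , jh₂ , Kk₂) T₂ h₁≢h₂ spread =
      let (p , unique , pI , b∈p) = core Kk₁ Kk₂ spread
      in earThrough I-inner I-edgeOf h₁ jh₁ Kk₁ T₁ h₂ jh₂ Kk₂ T₂ h₁≢h₂ p unique pI refl b∈p

    attachmentAtBC : Σ E λ h → Σ V λ s → Attaches (λ w → w ≡ b ⊎ w ≡ c) h s × Terminal s
    attachmentAtBC = BeyondFirstEdge.attachment j₁ j₂ ib ic (λ e → f₁≢f₂ (sym e)) only-f₁f₂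

    attachmentAtBA : Σ E λ h → Σ V λ s → Attaches (λ w → w ≡ b ⊎ w ≡ a) h s × Terminal s
    attachmentAtBA = BeyondFirstEdge.attachment (Joins-sym j₂) (Joins-sym j₁) ib ia f₁≢f₂
                       (λ ie → swap (only-f₁f₂ ie))

    BC⇒K : ∀ {w} → w ≡ b ⊎ w ≡ c → K w
    BC⇒K = inj₂

    BA⇒K : ∀ {w} → w ≡ b ⊎ w ≡ a → K w
    BA⇒K (inj₁ w≡b) = inj₂ (inj₁ w≡b)
    BA⇒K (inj₂ w≡a) = inj₁ w≡a

    crossingFrom : ∀ {hx hy} (ax : Attaches K hx x) (ay : Attaches K hy y) →
                   Spread (proj₁ ax) (proj₁ ay) → Ears K (_≡ b)
    crossingFrom {hx} {hy} ax ay spread = crossing (proj₁ P) (proj₁ Q) (proj₂ P) (proj₂ Q)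
      where
      hx≢hy = x-attachment≢y-attachment K-inner ax ay
      P = ear hx ax x-terminal hy ay y-terminal hx≢hy spread
      Q = ear hy ay y-terminal hx ax x-terminal (λ e → hx≢hy (sym e)) (Spread-sym spread)

    -- If x and y attach at the same vertex, a third attachment at another vertex replaces one of them.
    crossingVia : ∀ {hx hy h s} (ax : Attaches K hx x) (ay : Attaches K hy y) → proj₁ ax ≡ proj₁ ay →
                  (a′ : Attaches K h s) → Terminal s → proj₁ a′ ≢ proj₁ ax → Ears K (_≡ b)
    crossingVia ax ay kx≡ky a′ (inj₁ refl) k≢kx = crossingFrom a′ ay (inj₁ (λ e → k≢kx (trans e (sym kx≡ky))))
    crossingVia ax ay kx≡ky a′ (inj₂ refl) k≢kx = crossingFrom ax a′ (inj₁ (λ e → k≢kx (sym e)))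

    sharedEnd : ∀ {hx hy} (ax : Attaches K hx x) (ay : Attaches K hy y) → proj₁ ax ≡ proj₁ ay → Ears K (_≡ b)
    sharedEnd ax@(_ , _ , inj₂ (inj₁ refl)) ay _ = crossingFrom ax ay (inj₂ refl)
    sharedEnd ax@(_ , _ , inj₁ refl) ay kx≡ky =
      let (_ , _ , (k , j , BCk) , Ts) = attachmentAtBC
      in crossingVia ax ay kx≡ky (k , j , BC⇒K BCk) Ts (≢a BCk)
      where
      ≢a : ∀ {w} → w ≡ b ⊎ w ≡ c → w ≢ a
      ≢a (inj₁ refl) b≡a = a≢b (sym b≡a)
      ≢a (inj₂ refl) c≡a = a≢c (sym c≡a)
    sharedEnd ax@(_ , _ , inj₂ (inj₂ refl)) ay kx≡ky =
      let (_ , _ , (k , j , BAk) , Ts) = attachmentAtBA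
      in crossingVia ax ay kx≡ky (k , j , BA⇒K BAk) Ts (≢c BAk)
      where
      ≢c : ∀ {w} → w ≡ b ⊎ w ≡ a → w ≢ c
      ≢c (inj₁ refl) = b≢c
      ≢c (inj₂ refl) = a≢c

    loopThroughMiddle : ∀ {s h s₀} → (∀ {h s′} → Attaches K h s′ → Terminal s′ → s′ ≡ s) →
                        Joins G h b s₀ → Terminal s₀ → Σ (Walk G s s) (Ear K (_≡ b))
    loopThroughMiddle {h = h} only-s j T with anotherAttachment (b , j , inj₂ (inj₁ refl)) T
    ... | h′ , h′≢h , s′ , a′ , T′ with only-s (b , j , inj₂ (inj₁ refl)) T | only-s a′ T′
    ...   | refl | refl = ear h (b , j , inj₂ (inj₁ refl)) T h′ a′ T′ (λ e → h′≢h (sym e)) (inj₂ refl)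

    loopAt : ∀ {s} → (∀ {h s′} → Attaches K h s′ → Terminal s′ → s′ ≡ s) → Σ (Walk G s s) (Ear K (_≡ b))
    loopAt only-s with attachmentAtBC | attachmentAtBA
    ... | _ , _ , (_ , jα , inj₁ refl) , Tα | _ = loopThroughMiddle only-s jα Tα
    ... | _ | _ , _ , (_ , jβ , inj₁ refl) , Tβ = loopThroughMiddle only-s jβ Tβ
    ... | hα , _ , (_ , jα , inj₂ refl) , Tα | hβ , _ , (_ , jβ , inj₂ refl) , Tβ
          with only-s (c , jα , inj₂ (inj₂ refl)) Tα | only-s (a , jβ , inj₁ refl) Tβ
    ...   | refl | refl = ear hβ (a , jβ , inj₁ refl) Tβ hα (c , jα , inj₂ (inj₂ refl)) Tα
                              (attachments-from-distinct-ends jβ jα a≢c) (inj₁ a≢c)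

    ears : Ears K (_≡ b)
    ears with attached? x | attached? y
    ... | yes (hx , ax) | yes (hy , ay) with proj₁ ax ≟ proj₁ ay
    ...   | no kx≢ky = crossingFrom ax ay (inj₁ kx≢ky)
    ...   | yes kx≡ky = sharedEnd ax ay kx≡ky
    ears | yes _ | no ¬y = let (p , ep) = loopAt (attachment-at-x ¬y) in loopAtX p ep ¬y
    ears | no ¬x | yes _ = let (p , ep) = loopAt (attachment-at-y ¬x) in loopAtY p ep ¬x
    ears | no ¬x | no ¬y with attachment
    ... | h , _ , ah , inj₁ refl = ⊥-elim (¬x (h , ah))
    ... | h , _ , ah , inj₂ refl = ⊥-elim (¬y (h , ah))

  BypassEdge : (V → Set) → E → Set
  BypassEdge S e = e ≢ e₀ × (Joins G e x y ⊎ EdgeOf S e)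

  EdgeOf-BypassEdge-disjoint : ∀ {K S e} → InnerSet K → InnerSet S → (∀ {v} → K v → S v → ⊥) →
                               EdgeOf K e → BypassEdge S e → ⊥
  EdgeOf-BypassEdge-disjoint K-inner S-inner K∩S=∅ eK (_ , inj₁ jxy) = EdgeOf⇒¬Joins-xy K-inner eK jxy
  EdgeOf-BypassEdge-disjoint K-inner S-inner K∩S=∅ eK (_ , inj₂ eS) = EdgeOf-disjoint K-inner S-inner K∩S=∅ eK eS

  -- An x-y trail avoiding e₀ whose only inner vertex, if any, lies in S, outside the loops L.
  Bypass : (V → Set) → Set₁
  Bypass L = Σ (V → Set) λ S → InnerSet S × (∀ {v} → L v → S v → ⊥) ×
             Σ (Walk G x y) λ p → Unique (walkEdges G p) × All (BypassEdge S) (walkEdges G p)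

  -- L is a union of components carrying loops: those in Lx hang at x only, the others at y only.
  module BypassConstruction (d : Walk G x y) (d-avoids : All (_≢ e₀) (walkEdges G d))
                            (L : V → Set) (L? : Decidable L) (L-inner : InnerSet L)
                            (Lx : V → Set) (Lx? : Decidable Lx) (Lx⊆L : ∀ {v} → Lx v → L v)
                            (Lx-¬y : ∀ {e k} → Lx k → ¬ Joins G e k y)
                            (Ly-¬x : ∀ {e k} → L k → ¬ Lx k → ¬ Joins G e k x)
                            (inner-edge : ∀ {g s t} → Joins G g s t → Inner s → Inner t → L s × (Lx s → Lx t)) where

    NearX : V → Set
    NearX v = v ≢ y × (v ≡ x ⊎ (Σ E λ h → h ≢ e₀ × Joins G h x v) ⊎ Lx v)

    nearX? : Decidable NearX
    nearX? v = ¬? (v ≟ y) ×-dec ((v ≟ x) ⊎-dec any? (λ h → ¬? (h ≟ e₀) ×-dec Joins? h x v) ⊎-dec Lx? v)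

    neighbour-inner : ∀ {h s} → Joins G h x s → s ≢ y → Inner s
    neighbour-inner jh s≢y (inj₁ refl) = Joins⇒≢ jh refl
    neighbour-inner jh s≢y (inj₂ refl) = s≢y refl

    -- The detour d leaves NearX; its last step there either reaches y or contradicts the hypotheses.
    bypass : Bypass L
    bypass with leavingEdge NearX nearX? d (x≢y , inj₁ refl) (λ near-y → proj₁ near-y refl)
    ... | g , g∈d , s , t , j , (s≢y , near-s) , ¬near-t with t ≟ y
    bypass | g , g∈d , s , t , j , (s≢y , inj₁ refl) , _ | yes refl =
      (λ _ → ⊥) , (λ ()) , (λ _ ()) , step g j [] , [] ∷ [] , (All.lookup d-avoids g∈d , inj₁ j) ∷ []
    bypass | g , g∈d , s , t , j , (s≢y , inj₂ (inj₁ (h , h≢e₀ , jh))) , _ | yes refl with L? s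
    ... | yes Ls with Lx? s
    ...   | yes Lxs = ⊥-elim (Lx-¬y Lxs j)
    ...   | no ¬Lxs = ⊥-elim (Ly-¬x Ls ¬Lxs (Joins-sym jh))
    bypass | g , g∈d , s , t , j , (s≢y , inj₂ (inj₁ (h , h≢e₀ , jh))) , _ | yes refl | no ¬Ls =
      (_≡ s) , (λ { refl → neighbour-inner jh s≢y }) , (λ { Lv refl → ¬Ls Lv }) ,
      step h jh (step g j []) , (h≢g ∷ []) ∷ [] ∷ [] ,
      (h≢e₀ , inj₂ (s , x , Joins-sym jh , refl , inj₂ x-terminal)) ∷
      (All.lookup d-avoids g∈d , inj₂ (s , y , j , refl , inj₂ y-terminal)) ∷ []
      where
      h≢g : h ≢ g
      h≢g refl with Joins-unique jh j
      ... | inj₁ (x≡s , _) = Joins⇒≢ jh x≡s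
      ... | inj₂ (x≡y , _) = x≢y x≡y
    bypass | g , g∈d , s , t , j , (s≢y , inj₂ (inj₂ Lxs)) , _ | yes refl = ⊥-elim (Lx-¬y Lxs j)
    bypass | g , g∈d , s , t , j , (s≢y , near-s) , ¬near-t | no t≢y = ⊥-elim (stays near-s)
      where
      t-inner : Inner t
      t-inner (inj₁ t≡x) = ¬near-t (t≢y , inj₁ t≡x)
      t-inner (inj₂ t≡y) = t≢y t≡y
      stays : ¬ (s ≡ x ⊎ (Σ E λ h → h ≢ e₀ × Joins G h x s) ⊎ Lx s)
      stays (inj₁ refl) = ¬near-t (t≢y , inj₂ (inj₁ (g , All.lookup d-avoids g∈d , j)))
      stays (inj₂ (inj₁ (h , _ , jh))) with inner-edge j (neighbour-inner jh s≢y) t-inner | Lx? s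
      ... | _ , Lx-closed | yes Lxs = ¬near-t (t≢y , inj₂ (inj₂ (Lx-closed Lxs)))
      ... | Ls , _ | no ¬Lxs = Ly-¬x Ls ¬Lxs (Joins-sym jh)
      stays (inj₂ (inj₂ Lxs)) =
        ¬near-t (t≢y , inj₂ (inj₂ (proj₂ (inner-edge j (L-inner (Lx⊆L Lxs)) t-inner) Lxs)))

  DominatingTrailThroughXY : Set
  DominatingTrailThroughXY = Σ (ClosedTrail G) (λ T → Dominating G T × onTrail G T x × onTrail G T y)

  dominatingTrail : (Lx : Walk G x x) (P : Walk G x y) (Ly : Walk G y y) (Q : Walk G y x) →
    Unique (walkEdges G Lx) → Unique (walkEdges G P) → Unique (walkEdges G Ly) → Unique (walkEdges G Q) →
    Disjoint (walkEdges G Lx) (walkEdges G P) → Disjoint (walkEdges G Lx) (walkEdges G Ly) →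
    Disjoint (walkEdges G Lx) (walkEdges G Q) → Disjoint (walkEdges G P) (walkEdges G Ly) →
    Disjoint (walkEdges G P) (walkEdges G Q) → Disjoint (walkEdges G Ly) (walkEdges G Q) →
    (∀ e → InnerEdge e → Σ V λ w → Incident G w e ×
       (w ∈ walkVertices G Lx ⊎ w ∈ walkVertices G P ⊎ w ∈ walkVertices G Ly ⊎ w ∈ walkVertices G Q)) →
    DominatingTrailThroughXY
  dominatingTrail Lx P Ly Q u₁ u₂ u₃ u₄ d₁₂ d₁₃ d₁₄ d₂₃ d₂₄ d₃₄ covered =
    T , dominating , start∈walkVertices W , y∈W
    where
    W : Walk G x x
    W = Lx ++ʷ (P ++ʷ (Ly ++ʷ Q))
    edges-eq : walkEdges G W ≡ walkEdges G Lx ++ (walkEdges G P ++ (walkEdges G Ly ++ walkEdges G Q))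
    edges-eq = trans (walkEdges-++ʷ Lx _)
                     (cong (walkEdges G Lx ++_) (trans (walkEdges-++ʷ P _) (cong (walkEdges G P ++_) (walkEdges-++ʷ Ly Q))))
    isTrail : Unique (walkEdges G Lx ++ (walkEdges G P ++ (walkEdges G Ly ++ walkEdges G Q)))
    isTrail = Unique.++⁺ u₁ (Unique.++⁺ u₂ (Unique.++⁺ u₃ u₄ d₃₄) (Disjoint-++ʳ d₂₃ d₂₄))
                         (Disjoint-++ʳ d₁₂ (Disjoint-++ʳ d₁₃ d₁₄))
    T : ClosedTrail G
    T = record { base = x ; walk = W ; trail = subst Unique (sym edges-eq) isTrail }
    y∈W : y ∈ walkVertices G W
    y∈W = walkVertices-++ʷʳ Lx _ (walkVertices-++ʷʳ P _ (start∈walkVertices (Ly ++ʷ Q)))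
    on-W : ∀ {w} → (w ∈ walkVertices G Lx ⊎ w ∈ walkVertices G P ⊎ w ∈ walkVertices G Ly ⊎ w ∈ walkVertices G Q) →
           w ∈ walkVertices G W
    on-W (inj₁ i) = walkVertices-++ʷˡ Lx _ i
    on-W (inj₂ (inj₁ i)) = walkVertices-++ʷʳ Lx _ (walkVertices-++ʷˡ P _ i)
    on-W (inj₂ (inj₂ (inj₁ i))) = walkVertices-++ʷʳ Lx _ (walkVertices-++ʷʳ P _ (walkVertices-++ʷˡ Ly _ i))
    on-W (inj₂ (inj₂ (inj₂ i))) = walkVertices-++ʷʳ Lx _ (walkVertices-++ʷʳ P _ (walkVertices-++ʷʳ Ly _ i))
    terminal-on-W : ∀ {v} → Terminal v → v ∈ walkVertices G W
    terminal-on-W (inj₁ refl) = start∈walkVertices W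
    terminal-on-W (inj₂ refl) = y∈W
    dominating : Dominating G T
    dominating e with terminal? (end₁ e) | terminal? (end₂ e)
    ... | yes T₁ | _ = inj₁ (terminal-on-W T₁)
    ... | no _ | yes T₂ = inj₂ (terminal-on-W T₂)
    ... | no i₁ | no i₂ with covered e (i₁ , i₂)
    ...   | w , inj₁ refl , w∈ = inj₁ (on-W w∈)
    ...   | w , inj₂ refl , w∈ = inj₂ (on-W w∈)

  Covers : (V → Set) → E → Set
  Covers C e = ∀ {w} → C w → Incident G w e

  detached : ∀ {K s} → ¬ Attached K s → ∀ {e k} → K k → ¬ Joins G e k s
  detached ¬attached Kk j = ¬attached (_ , _ , j , Kk)

  e₀-back : Walk G y x
  e₀-back = step e₀ (Joins-sym xy) []

  e₀-back-edges : All (_≡ e₀) (walkEdges G e₀-back)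
  e₀-back-edges = refl ∷ []

  e₀-back-trail : Unique (walkEdges G e₀-back)
  e₀-back-trail = [] ∷ []

  module Assembly (d : Walk G x y) (d-avoids : All (_≢ e₀) (walkEdges G d)) where
    open BypassConstruction d d-avoids using (bypass)

    noInnerEdge : (∀ e → ¬ InnerEdge e) → DominatingTrailThroughXY
    noInnerEdge none
      with bypass (λ _ → ⊥) (λ _ → no λ ()) (λ ()) (λ _ → ⊥) (λ _ → no λ ()) (λ ())
                  (λ ()) (λ ()) (λ j is it → ⊥-elim (none _ (Joins⇒InnerEdge j is it)))
    ... | _ , _ , _ , p , up , ap =
      dominatingTrail [] p [] e₀-back [] up [] e₀-back-trail Disjoint-[]ˡ Disjoint-[]ˡ Disjoint-[]ˡ Disjoint-[]ʳ
        (All⇒Disjoint ap e₀-back-edges proj₁) Disjoint-[]ˡ (λ e ie → ⊥-elim (none e ie))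

    oneComponent : (K : V → Set) → Decidable K → InnerSet K → (C : V → Set) → Ears K C →
                   (∀ {g s t} → Joins G g s t → Inner s → Inner t → K s × K t) →
                   (∀ e → InnerEdge e → Covers C e) → DominatingTrailThroughXY
    oneComponent K K? K-inner C (crossing p _ (up , ap , w , Cw , w∈p) _) K-all covers =
      dominatingTrail [] p [] e₀-back [] up [] e₀-back-trail Disjoint-[]ˡ Disjoint-[]ˡ Disjoint-[]ˡ Disjoint-[]ʳ
        (All⇒Disjoint ap e₀-back-edges (EdgeOf⇒≢e₀ K-inner)) Disjoint-[]ˡ
        (λ e ie → w , covers e ie Cw , inj₂ (inj₁ w∈p))
    oneComponent K K? K-inner C (loopAtX L (uL , aL , w , Cw , w∈L) ¬y) K-all covers
      with bypass K K? K-inner K K? (λ Kk → Kk) (detached ¬y) (λ Kk ¬Kk _ → ¬Kk Kk)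
                  (λ j is it → proj₁ (K-all j is it) , λ _ → proj₂ (K-all j is it))
    ... | S , S-inner , K∩S=∅ , p , up , ap =
      dominatingTrail L p [] e₀-back uL up [] e₀-back-trail
        (All⇒Disjoint aL ap (EdgeOf-BypassEdge-disjoint K-inner S-inner K∩S=∅)) Disjoint-[]ʳ
        (All⇒Disjoint aL e₀-back-edges (EdgeOf⇒≢e₀ K-inner)) Disjoint-[]ʳ
        (All⇒Disjoint ap e₀-back-edges proj₁) Disjoint-[]ˡ
        (λ e ie → w , covers e ie Cw , inj₁ w∈L)
    oneComponent K K? K-inner C (loopAtY L (uL , aL , w , Cw , w∈L) ¬x) K-all covers
      with bypass K K? K-inner (λ _ → ⊥) (λ _ → no λ ()) (λ ()) (λ ()) (λ Kk _ → detached ¬x Kk)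
                  (λ j is it → proj₁ (K-all j is it) , λ ())
    ... | S , S-inner , K∩S=∅ , p , up , ap =
      dominatingTrail [] p L e₀-back [] up uL e₀-back-trail Disjoint-[]ˡ Disjoint-[]ˡ Disjoint-[]ˡ
        (All⇒Disjoint ap aL (λ r eK → EdgeOf-BypassEdge-disjoint K-inner S-inner K∩S=∅ eK r))
        (All⇒Disjoint ap e₀-back-edges proj₁) (All⇒Disjoint aL e₀-back-edges (EdgeOf⇒≢e₀ K-inner))
        (λ e ie → w , covers e ie Cw , inj₂ (inj₂ (inj₁ w∈L)))

    module TwoComponents (K₁ : V → Set) (K₁? : Decidable K₁) (K₁-inner : InnerSet K₁) (C₁ : V → Set)
                         (K₂ : V → Set) (K₂? : Decidable K₂) (K₂-inner : InnerSet K₂) (C₂ : V → Set)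
                         (K₁∩K₂=∅ : ∀ {v} → K₁ v → K₂ v → ⊥)
                         (K-all : ∀ {g s t} → Joins G g s t → Inner s → Inner t → (K₁ s × K₁ t) ⊎ (K₂ s × K₂ t))
                         (covers : ∀ e → InnerEdge e → Covers C₁ e ⊎ Covers C₂ e) where

      K₁₂ : V → Set
      K₁₂ v = K₁ v ⊎ K₂ v

      K₁₂? : Decidable K₁₂
      K₁₂? v = K₁? v ⊎-dec K₂? v

      K₁₂-inner : InnerSet K₁₂
      K₁₂-inner (inj₁ K₁v) = K₁-inner K₁v
      K₁₂-inner (inj₂ K₂v) = K₂-inner K₂v

      K₁₂-all : ∀ {g s t} → Joins G g s t → Inner s → Inner t → K₁₂ s × K₁₂ t
      K₁₂-all j is it with K-all j is it
      ... | inj₁ (K₁s , K₁t) = inj₁ K₁s , inj₁ K₁t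
      ... | inj₂ (K₂s , K₂t) = inj₂ K₂s , inj₂ K₂t

      EdgeOf₁∩₂=∅ : ∀ {e} → EdgeOf K₁ e → EdgeOf K₂ e → ⊥
      EdgeOf₁∩₂=∅ = EdgeOf-disjoint K₁-inner K₂-inner K₁∩K₂=∅

      EdgeOf₂∩₁=∅ : ∀ {e} → EdgeOf K₂ e → EdgeOf K₁ e → ⊥
      EdgeOf₂∩₁=∅ e₂ e₁ = EdgeOf₁∩₂=∅ e₁ e₂

      coveredBy : (On : V → Set) → ∀ {w₁ w₂} → C₁ w₁ → On w₁ → C₂ w₂ → On w₂ →
                  ∀ e → InnerEdge e → Σ V λ w → Incident G w e × On w
      coveredBy On {w₁} {w₂} C₁w₁ on₁ C₂w₂ on₂ e ie with covers e ie
      ... | inj₁ cov₁ = w₁ , cov₁ C₁w₁ , on₁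
      ... | inj₂ cov₂ = w₂ , cov₂ C₂w₂ , on₂

      mergeLoops : ∀ {s} (L₁ L₂ : Walk G s s) → Unique (walkEdges G L₁) → Unique (walkEdges G L₂) →
                   All (EdgeOf K₁) (walkEdges G L₁) → All (EdgeOf K₂) (walkEdges G L₂) →
                   Σ (Walk G s s) λ L → Unique (walkEdges G L) × All (EdgeOf K₁₂) (walkEdges G L) ×
                     (∀ {w} → w ∈ walkVertices G L₁ → w ∈ walkVertices G L) ×
                     (∀ {w} → w ∈ walkVertices G L₂ → w ∈ walkVertices G L)
      mergeLoops L₁ L₂ u₁ u₂ a₁ a₂ =
        L₁ ++ʷ L₂ ,
        subst Unique (sym (walkEdges-++ʷ L₁ L₂)) (Unique.++⁺ u₁ u₂ (All⇒Disjoint a₁ a₂ EdgeOf₁∩₂=∅)) ,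
        subst (All (EdgeOf K₁₂)) (sym (walkEdges-++ʷ L₁ L₂)) (All.++⁺ (All.map EdgeOf-⊎ˡ a₁) (All.map EdgeOf-⊎ʳ a₂)) ,
        walkVertices-++ʷˡ L₁ L₂ , walkVertices-++ʷʳ L₁ L₂

      crossingFirst : (p₁ : Walk G x y) → Ear K₁ C₁ p₁ → Ears K₂ C₂ → DominatingTrailThroughXY
      crossingFirst p₁ (u₁ , a₁ , _ , c₁ , i₁) (crossing _ q₂ _ (v₂ , b₂ , _ , c₂ , i₂)) =
        dominatingTrail [] p₁ [] q₂ [] u₁ [] v₂ Disjoint-[]ˡ Disjoint-[]ˡ Disjoint-[]ˡ Disjoint-[]ʳ
          (All⇒Disjoint a₁ b₂ EdgeOf₁∩₂=∅) Disjoint-[]ˡ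
          (coveredBy _ c₁ (inj₂ (inj₁ i₁)) c₂ (inj₂ (inj₂ (inj₂ i₂))))
      crossingFirst p₁ (u₁ , a₁ , _ , c₁ , i₁) (loopAtX L (uL , aL , _ , c₂ , i₂) _) =
        dominatingTrail L p₁ [] e₀-back uL u₁ [] e₀-back-trail (All⇒Disjoint aL a₁ EdgeOf₂∩₁=∅) Disjoint-[]ʳ
          (All⇒Disjoint aL e₀-back-edges (EdgeOf⇒≢e₀ K₂-inner)) Disjoint-[]ʳ
          (All⇒Disjoint a₁ e₀-back-edges (EdgeOf⇒≢e₀ K₁-inner)) Disjoint-[]ˡ
          (coveredBy _ c₁ (inj₂ (inj₁ i₁)) c₂ (inj₁ i₂))
      crossingFirst p₁ (u₁ , a₁ , _ , c₁ , i₁) (loopAtY L (uL , aL , _ , c₂ , i₂) _) =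
        dominatingTrail [] p₁ L e₀-back [] u₁ uL e₀-back-trail Disjoint-[]ˡ Disjoint-[]ˡ Disjoint-[]ˡ
          (All⇒Disjoint a₁ aL EdgeOf₁∩₂=∅) (All⇒Disjoint a₁ e₀-back-edges (EdgeOf⇒≢e₀ K₁-inner))
          (All⇒Disjoint aL e₀-back-edges (EdgeOf⇒≢e₀ K₂-inner))
          (coveredBy _ c₁ (inj₂ (inj₁ i₁)) c₂ (inj₂ (inj₂ (inj₁ i₂))))

      loopAtXThenCrossing : (L : Walk G x x) → Ear K₁ C₁ L → (p₂ : Walk G x y) → Ear K₂ C₂ p₂ →
                            DominatingTrailThroughXY
      loopAtXThenCrossing L (uL , aL , _ , c₁ , i₁) p₂ (u₂ , a₂ , _ , c₂ , i₂) =
        dominatingTrail L p₂ [] e₀-back uL u₂ [] e₀-back-trail (All⇒Disjoint aL a₂ EdgeOf₁∩₂=∅) Disjoint-[]ʳ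
          (All⇒Disjoint aL e₀-back-edges (EdgeOf⇒≢e₀ K₁-inner)) Disjoint-[]ʳ
          (All⇒Disjoint a₂ e₀-back-edges (EdgeOf⇒≢e₀ K₂-inner)) Disjoint-[]ˡ
          (coveredBy _ c₁ (inj₁ i₁) c₂ (inj₂ (inj₁ i₂)))

      loopAtYThenCrossing : (L : Walk G y y) → Ear K₁ C₁ L → (p₂ : Walk G x y) → Ear K₂ C₂ p₂ →
                            DominatingTrailThroughXY
      loopAtYThenCrossing L (uL , aL , _ , c₁ , i₁) p₂ (u₂ , a₂ , _ , c₂ , i₂) =
        dominatingTrail [] p₂ L e₀-back [] u₂ uL e₀-back-trail Disjoint-[]ˡ Disjoint-[]ˡ Disjoint-[]ˡ
          (All⇒Disjoint a₂ aL EdgeOf₂∩₁=∅) (All⇒Disjoint a₂ e₀-back-edges (EdgeOf⇒≢e₀ K₂-inner))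
          (All⇒Disjoint aL e₀-back-edges (EdgeOf⇒≢e₀ K₁-inner))
          (coveredBy _ c₁ (inj₂ (inj₂ (inj₁ i₁))) c₂ (inj₂ (inj₁ i₂)))

      bothLoopsAtX : (L₁ L₂ : Walk G x x) → Ear K₁ C₁ L₁ → Ear K₂ C₂ L₂ → ¬ Attached K₁ y → ¬ Attached K₂ y →
                     DominatingTrailThroughXY
      bothLoopsAtX L₁ L₂ (u₁ , a₁ , _ , c₁ , i₁) (u₂ , a₂ , _ , c₂ , i₂) ¬y₁ ¬y₂
        with mergeLoops L₁ L₂ u₁ u₂ a₁ a₂
      ... | L , uL , aL , L₁⊆L , L₂⊆L
        with bypass K₁₂ K₁₂? K₁₂-inner K₁₂ K₁₂? (λ K → K)
                    (λ { (inj₁ K₁k) → detached ¬y₁ K₁k ; (inj₂ K₂k) → detached ¬y₂ K₂k })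
                    (λ K ¬K _ → ¬K K) (λ j is it → proj₁ (K₁₂-all j is it) , λ _ → proj₂ (K₁₂-all j is it))
      ... | S , S-inner , K∩S=∅ , p , up , ap =
        dominatingTrail L p [] e₀-back uL up [] e₀-back-trail
          (All⇒Disjoint aL ap (EdgeOf-BypassEdge-disjoint K₁₂-inner S-inner K∩S=∅)) Disjoint-[]ʳ
          (All⇒Disjoint aL e₀-back-edges (EdgeOf⇒≢e₀ K₁₂-inner)) Disjoint-[]ʳ
          (All⇒Disjoint ap e₀-back-edges proj₁) Disjoint-[]ˡ
          (coveredBy _ c₁ (inj₁ (L₁⊆L i₁)) c₂ (inj₁ (L₂⊆L i₂)))

      bothLoopsAtY : (L₁ L₂ : Walk G y y) → Ear K₁ C₁ L₁ → Ear K₂ C₂ L₂ → ¬ Attached K₁ x → ¬ Attached K₂ x →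
                     DominatingTrailThroughXY
      bothLoopsAtY L₁ L₂ (u₁ , a₁ , _ , c₁ , i₁) (u₂ , a₂ , _ , c₂ , i₂) ¬x₁ ¬x₂
        with mergeLoops L₁ L₂ u₁ u₂ a₁ a₂
      ... | L , uL , aL , L₁⊆L , L₂⊆L
        with bypass K₁₂ K₁₂? K₁₂-inner (λ _ → ⊥) (λ _ → no λ ()) (λ ()) (λ ())
                    (λ { (inj₁ K₁k) _ → detached ¬x₁ K₁k ; (inj₂ K₂k) _ → detached ¬x₂ K₂k })
                    (λ j is it → proj₁ (K₁₂-all j is it) , λ ())
      ... | S , S-inner , K∩S=∅ , p , up , ap =
        dominatingTrail [] p L e₀-back [] up uL e₀-back-trail Disjoint-[]ˡ Disjoint-[]ˡ Disjoint-[]ˡ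
          (All⇒Disjoint ap aL (λ r eK → EdgeOf-BypassEdge-disjoint K₁₂-inner S-inner K∩S=∅ eK r))
          (All⇒Disjoint ap e₀-back-edges proj₁) (All⇒Disjoint aL e₀-back-edges (EdgeOf⇒≢e₀ K₁₂-inner))
          (coveredBy _ c₁ (inj₂ (inj₂ (inj₁ (L₁⊆L i₁)))) c₂ (inj₂ (inj₂ (inj₁ (L₂⊆L i₂)))))

      loopsAtXAndY : (L₁ : Walk G x x) (L₂ : Walk G y y) → Ear K₁ C₁ L₁ → Ear K₂ C₂ L₂ →
                     ¬ Attached K₁ y → ¬ Attached K₂ x → DominatingTrailThroughXY
      loopsAtXAndY L₁ L₂ (u₁ , a₁ , _ , c₁ , i₁) (u₂ , a₂ , _ , c₂ , i₂) ¬y₁ ¬x₂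
        with bypass K₁₂ K₁₂? K₁₂-inner K₁ K₁? inj₁ (detached ¬y₁)
                    (λ { (inj₁ K₁k) ¬K₁k _ → ¬K₁k K₁k ; (inj₂ K₂k) _ → detached ¬x₂ K₂k })
                    (λ j is it → stays (K-all j is it))
        where
        stays : ∀ {s t} → (K₁ s × K₁ t) ⊎ (K₂ s × K₂ t) → K₁₂ s × (K₁ s → K₁ t)
        stays (inj₁ (K₁s , K₁t)) = inj₁ K₁s , λ _ → K₁t
        stays (inj₂ (K₂s , _)) = inj₂ K₂s , λ K₁s → ⊥-elim (K₁∩K₂=∅ K₁s K₂s)
      ... | S , S-inner , K∩S=∅ , p , up , ap =
        dominatingTrail L₁ p L₂ e₀-back u₁ up u₂ e₀-back-trail
          (All⇒Disjoint a₁ ap (λ eK r → EdgeOf-BypassEdge-disjoint K₁₂-inner S-inner K∩S=∅ (EdgeOf-⊎ˡ eK) r))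
          (All⇒Disjoint a₁ a₂ EdgeOf₁∩₂=∅) (All⇒Disjoint a₁ e₀-back-edges (EdgeOf⇒≢e₀ K₁-inner))
          (All⇒Disjoint ap a₂ (λ r eK → EdgeOf-BypassEdge-disjoint K₁₂-inner S-inner K∩S=∅ (EdgeOf-⊎ʳ eK) r))
          (All⇒Disjoint ap e₀-back-edges proj₁) (All⇒Disjoint a₂ e₀-back-edges (EdgeOf⇒≢e₀ K₂-inner))
          (coveredBy _ c₁ (inj₁ i₁) c₂ (inj₂ (inj₂ (inj₁ i₂))))

      loopsAtYAndX : (L₁ : Walk G y y) (L₂ : Walk G x x) → Ear K₁ C₁ L₁ → Ear K₂ C₂ L₂ →
                     ¬ Attached K₁ x → ¬ Attached K₂ y → DominatingTrailThroughXY
      loopsAtYAndX L₁ L₂ (u₁ , a₁ , _ , c₁ , i₁) (u₂ , a₂ , _ , c₂ , i₂) ¬x₁ ¬y₂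
        with bypass K₁₂ K₁₂? K₁₂-inner K₂ K₂? inj₂ (detached ¬y₂)
                    (λ { (inj₂ K₂k) ¬K₂k _ → ¬K₂k K₂k ; (inj₁ K₁k) _ → detached ¬x₁ K₁k })
                    (λ j is it → stays (K-all j is it))
        where
        stays : ∀ {s t} → (K₁ s × K₁ t) ⊎ (K₂ s × K₂ t) → K₁₂ s × (K₂ s → K₂ t)
        stays (inj₂ (K₂s , K₂t)) = inj₂ K₂s , λ _ → K₂t
        stays (inj₁ (K₁s , _)) = inj₁ K₁s , λ K₂s → ⊥-elim (K₁∩K₂=∅ K₁s K₂s)
      ... | S , S-inner , K∩S=∅ , p , up , ap =
        dominatingTrail L₂ p L₁ e₀-back u₂ up u₁ e₀-back-trail
          (All⇒Disjoint a₂ ap (λ eK r → EdgeOf-BypassEdge-disjoint K₁₂-inner S-inner K∩S=∅ (EdgeOf-⊎ʳ eK) r))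
          (All⇒Disjoint a₂ a₁ EdgeOf₂∩₁=∅) (All⇒Disjoint a₂ e₀-back-edges (EdgeOf⇒≢e₀ K₂-inner))
          (All⇒Disjoint ap a₁ (λ r eK → EdgeOf-BypassEdge-disjoint K₁₂-inner S-inner K∩S=∅ (EdgeOf-⊎ˡ eK) r))
          (All⇒Disjoint ap e₀-back-edges proj₁) (All⇒Disjoint a₁ e₀-back-edges (EdgeOf⇒≢e₀ K₁-inner))
          (coveredBy _ c₁ (inj₂ (inj₂ (inj₁ i₁))) c₂ (inj₁ i₂))

      twoComponents : Ears K₁ C₁ → Ears K₂ C₂ → DominatingTrailThroughXY
      twoComponents (crossing p₁ _ e₁ _) ears₂ = crossingFirst p₁ e₁ ears₂
      twoComponents (loopAtX L₁ e₁ _) (crossing p₂ _ e₂ _) = loopAtXThenCrossing L₁ e₁ p₂ e₂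
      twoComponents (loopAtY L₁ e₁ _) (crossing p₂ _ e₂ _) = loopAtYThenCrossing L₁ e₁ p₂ e₂
      twoComponents (loopAtX L₁ e₁ ¬y₁) (loopAtX L₂ e₂ ¬y₂) = bothLoopsAtX L₁ L₂ e₁ e₂ ¬y₁ ¬y₂
      twoComponents (loopAtY L₁ e₁ ¬x₁) (loopAtY L₂ e₂ ¬x₂) = bothLoopsAtY L₁ L₂ e₁ e₂ ¬x₁ ¬x₂
      twoComponents (loopAtX L₁ e₁ ¬y₁) (loopAtY L₂ e₂ ¬x₂) = loopsAtXAndY L₁ L₂ e₁ e₂ ¬y₁ ¬x₂
      twoComponents (loopAtY L₁ e₁ ¬x₁) (loopAtX L₂ e₂ ¬y₂) = loopsAtYAndX L₁ L₂ e₁ e₂ ¬x₁ ¬y₂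

    singleEdgeComponent : (f : E) → InnerEdge f →
                          (∀ {e k t} → EndOf f k → Joins G e k t → Inner t → EndOf f t) →
                          (∀ {g s t} → Joins G g s t → Inner s → Inner t → EndOf f s × EndOf f t) →
                          (∀ e → InnerEdge e → Covers (EndOf f) e) → DominatingTrailThroughXY
    singleEdgeComponent f f-inner closed K-all covers = oneComponent K K? K-inner K ears K-all covers
      where open EdgeComponent (joins-ends f) f-inner closed

    pathComponent : ∀ {f₁ f₂ a b c} → Joins G f₁ a b → Joins G f₂ b c → a ≢ c → Inner a → Inner b → Inner c →
                    (∀ {e} → InnerEdge e → e ≡ f₁ ⊎ e ≡ f₂) → DominatingTrailThroughXY
    pathComponent {b = b} j₁ j₂ a≢c ia ib ic only-f₁f₂ = oneComponent K K? K-inner (_≡ b) ears K-all covers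
      where
      open PathComponent j₁ j₂ a≢c ia ib ic only-f₁f₂
      K-all : ∀ {g s t} → Joins G g s t → Inner s → Inner t → K s × K t
      K-all j is it with only-f₁f₂ (Joins⇒InnerEdge j is it)
      ... | inj₁ refl with Joins-unique j j₁
      ...   | inj₁ (refl , refl) = inj₁ refl , inj₂ (inj₁ refl)
      ...   | inj₂ (refl , refl) = inj₂ (inj₁ refl) , inj₁ refl
      K-all j is it | inj₂ refl with Joins-unique j j₂
      ...   | inj₁ (refl , refl) = inj₂ (inj₁ refl) , inj₂ (inj₂ refl)
      ...   | inj₂ (refl , refl) = inj₂ (inj₂ refl) , inj₂ (inj₁ refl)
      covers : ∀ e → InnerEdge e → Covers (_≡ b) e
      covers e ie refl with only-f₁f₂ ie
      ... | inj₁ refl = Joins⇒Incident (Joins-sym j₁)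
      ... | inj₂ refl = Joins⇒Incident j₂

    singleInnerEdge : (f : E) → InnerEdge f → (∀ {e} → InnerEdge e → e ≡ f) → DominatingTrailThroughXY
    singleInnerEdge f f-inner only-f = singleEdgeComponent f f-inner closed K-all covers
      where
      closed : ∀ {e k t} → EndOf f k → Joins G e k t → Inner t → EndOf f t
      closed Kk j it with only-f (Joins⇒InnerEdge j (EndOf-inner f-inner Kk) it)
      ... | refl = proj₂ (Joins⇒EndOf j)
      K-all : ∀ {g s t} → Joins G g s t → Inner s → Inner t → EndOf f s × EndOf f t
      K-all j is it with only-f (Joins⇒InnerEdge j is it)
      ... | refl = Joins⇒EndOf j
      covers : ∀ e → InnerEdge e → Covers (EndOf f) e
      covers e ie with only-f ie
      ... | refl = EndOf⇒Incident

    module TwoInnerEdges (f₁ f₂ : E) (i₁ : InnerEdge f₁) (i₂ : InnerEdge f₂)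
                         (only-f₁f₂ : ∀ {e} → InnerEdge e → e ≡ f₁ ⊎ e ≡ f₂) where

      parallel : EndOf f₁ (end₁ f₂) → EndOf f₁ (end₂ f₂) → DominatingTrailThroughXY
      parallel p q = singleEdgeComponent f₁ i₁ closed K-all covers
        where
        closed : ∀ {e k t} → EndOf f₁ k → Joins G e k t → Inner t → EndOf f₁ t
        closed Kk j it with only-f₁f₂ (Joins⇒InnerEdge j (EndOf-inner i₁ Kk) it)
        ... | inj₁ refl = proj₂ (Joins⇒EndOf j)
        ... | inj₂ refl = EndOf-⊆ p q (proj₂ (Joins⇒EndOf j))
        K-all : ∀ {g s t} → Joins G g s t → Inner s → Inner t → EndOf f₁ s × EndOf f₁ t
        K-all j is it with only-f₁f₂ (Joins⇒InnerEdge j is it)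
        ... | inj₁ refl = Joins⇒EndOf j
        ... | inj₂ refl = EndOf-⊆ p q (proj₁ (Joins⇒EndOf j)) , EndOf-⊆ p q (proj₂ (Joins⇒EndOf j))
        covers : ∀ e → InnerEdge e → Covers (EndOf f₁) e
        covers e ie with only-f₁f₂ ie
        ... | inj₁ refl = EndOf⇒Incident
        ... | inj₂ refl = parallel-incident p q

      disjoint : ¬ EndOf f₁ (end₁ f₂) → ¬ EndOf f₁ (end₂ f₂) → DominatingTrailThroughXY
      disjoint ¬p ¬q =
        TwoComponents.twoComponents (EndOf f₁) (endOf? f₁) (EndOf-inner i₁) (EndOf f₁)
                                    (EndOf f₂) (endOf? f₂) (EndOf-inner i₂) (EndOf f₂) apart K-all covers
                                    (EdgeComponent.ears (joins-ends f₁) i₁ closed₁)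
                                    (EdgeComponent.ears (joins-ends f₂) i₂ closed₂)
        where
        apart : ∀ {v} → EndOf f₁ v → EndOf f₂ v → ⊥
        apart E₁ (inj₁ refl) = ¬p E₁
        apart E₁ (inj₂ refl) = ¬q E₁
        closed₁ : ∀ {e k t} → EndOf f₁ k → Joins G e k t → Inner t → EndOf f₁ t
        closed₁ Kk j it with only-f₁f₂ (Joins⇒InnerEdge j (EndOf-inner i₁ Kk) it)
        ... | inj₁ refl = proj₂ (Joins⇒EndOf j)
        ... | inj₂ refl = ⊥-elim (apart Kk (proj₁ (Joins⇒EndOf j)))
        closed₂ : ∀ {e k t} → EndOf f₂ k → Joins G e k t → Inner t → EndOf f₂ t
        closed₂ Kk j it with only-f₁f₂ (Joins⇒InnerEdge j (EndOf-inner i₂ Kk) it)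
        ... | inj₁ refl = ⊥-elim (apart (proj₁ (Joins⇒EndOf j)) Kk)
        ... | inj₂ refl = proj₂ (Joins⇒EndOf j)
        K-all : ∀ {g s t} → Joins G g s t → Inner s → Inner t → (EndOf f₁ s × EndOf f₁ t) ⊎ (EndOf f₂ s × EndOf f₂ t)
        K-all j is it with only-f₁f₂ (Joins⇒InnerEdge j is it)
        ... | inj₁ refl = inj₁ (Joins⇒EndOf j)
        ... | inj₂ refl = inj₂ (Joins⇒EndOf j)
        covers : ∀ e → InnerEdge e → Covers (EndOf f₁) e ⊎ Covers (EndOf f₂) e
        covers e ie with only-f₁f₂ ie
        ... | inj₁ refl = inj₁ EndOf⇒Incident
        ... | inj₂ refl = inj₂ EndOf⇒Incident

      adjacent : ∀ {a b c} → Joins G f₁ a b → Joins G f₂ b c → a ≢ c → DominatingTrailThroughXY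
      adjacent j₁ j₂ a≢c =
        pathComponent j₁ j₂ a≢c (proj₁ (InnerEdge⇒Inner j₁ i₁)) (proj₂ (InnerEdge⇒Inner j₁ i₁))
                      (proj₂ (InnerEdge⇒Inner j₂ i₂)) only-f₁f₂

      twoInnerEdges : DominatingTrailThroughXY
      twoInnerEdges with endOf? f₁ (end₁ f₂) | endOf? f₁ (end₂ f₂)
      ... | yes p | yes q = parallel p q
      ... | no ¬p | no ¬q = disjoint ¬p ¬q
      ... | yes (inj₁ p) | no ¬q =
            adjacent (Joins-sym (joins-ends f₁)) (subst (λ z → Joins G f₂ z (end₂ f₂)) p (joins-ends f₂))
                     (λ eq → ¬q (inj₂ (sym eq)))
      ... | yes (inj₂ p) | no ¬q =
            adjacent (joins-ends f₁) (subst (λ z → Joins G f₂ z (end₂ f₂)) p (joins-ends f₂))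
                     (λ eq → ¬q (inj₁ (sym eq)))
      ... | no ¬p | yes (inj₁ q) =
            adjacent (Joins-sym (joins-ends f₁)) (Joins-sym (subst (Joins G f₂ (end₁ f₂)) q (joins-ends f₂)))
                     (λ eq → ¬p (inj₂ (sym eq)))
      ... | no ¬p | yes (inj₂ q) =
            adjacent (joins-ends f₁) (Joins-sym (subst (Joins G f₂ (end₁ f₂)) q (joins-ends f₂)))
                     (λ eq → ¬p (inj₁ (sym eq)))

    byInnerEdges : (l : List E) → (∀ {e} → e ∈ l → InnerEdge e) → (∀ {e} → InnerEdge e → e ∈ l) →
                   length l ≤ 2 → DominatingTrailThroughXY
    byInnerEdges [] _ complete _ = noInnerEdge (λ e ie → ¬Any[] (complete ie))
    byInnerEdges (f ∷ []) sound complete _ =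
      singleInnerEdge f (sound (here refl)) (λ ie → Any.singleton⁻ (complete ie))
    byInnerEdges (f₁ ∷ f₂ ∷ []) sound complete _ =
      TwoInnerEdges.twoInnerEdges f₁ f₂ (sound (here refl)) (sound (there (here refl)))
                                  (λ ie → ∈-pair⁻ (complete ie))
    byInnerEdges (_ ∷ _ ∷ _ ∷ _) _ _ (s≤s (s≤s ()))

  dominatingClosedTrail : degree G x ≥ 2 → degree G y ≥ 2 → edgesAvoiding2 G x y ≤ 2 →
                          DominatingTrailThroughXY
  dominatingClosedTrail deg-x deg-y few-inner =
    Assembly.byInnerEdges (proj₁ detour) (proj₂ detour) innerEdges ∈innerEdges⇒InnerEdge InnerEdge⇒∈innerEdges few-inner
    where
    a = anotherIncidentEdge x e₀ deg-x
    b = anotherIncidentEdge y e₀ deg-y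
    detour : Σ (Walk G x y) λ p → All (_≢ e₀) (walkEdges G p)
    detour = walkAvoiding G ec e₀ (proj₁ a) (proj₁ b) (proj₂ (proj₂ a)) (proj₂ (proj₂ b))
                          (proj₂ (proj₁ (proj₂ a))) (proj₂ (proj₁ (proj₂ b)))

lemma13 : (G : Graph) → Essentially2EdgeConnected G →
    (x y : Vertex G) → Σ (Edge G) (λ e → Joins G e x y) →
    degree G x ≥ 2 → degree G y ≥ 2 →
    edgesAvoiding2 G x y ≤ 2 →
    Σ (ClosedTrail G) (λ T → Dominating G T × onTrail G T x × onTrail G T y)
lemma13 G ec x y (e₀ , xy) = TrailThroughEdge.dominatingClosedTrail G ec x y e₀ xy
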